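{- $\mathsf{Cnf}$ has classification: every $x : \mathsf{Cnf}$ is either zero, a strong successor, or a limit, i.e.\ $\mathsf{is\text{ - }zero}(x) \uplus \mathsf{is\text{ - }str\text{ - }suc}(x) \uplus \mathsf{is\text{ - }limit}(x)$ holds for all $x : \mathsf{Cnf}$.
   Context: Let $\mathcal{T}$ be the inductive type of unlabeled binary trees with constructors $\mathsf{leaf} : \mathcal{T}$ (written $0$) and $\mathsf{node} : \mathcal{T} \times \mathcal{T} \to \mathcal{T}$ (the tree $\mathsf{node}(a,b)$ represents the ordinal $\omega^a + b$). The relation $<$ on $\mathcal{T}$ is generated by: $0 < \mathsf{node}(a,b)$; $a < c \to \mathsf{node}(a,b) < \mathsf{node}(c,d)$; $b < d \to \mathsf{node}(a,b) < \mathsf{node}(a,d)$. Let $s \leq t := (s < t) \uplus (s = t)$. Let $\mathsf{left}(0) := 0$, $\mathsf{left}(\mathsf{node}(a,b)) := a$. The predicate $\mathsf{isCNF}$ is inductively generated by $\mathsf{isCNF}(0)$ and $\mathsf{isCNF}(s) \to \mathsf{isCNF}(t) \to \mathsf{left}(t) \leq s \to \mathsf{isCNF}(\mathsf{node}(s,t))$. $\mathsf{Cnf} := \Sigma(t : \mathcal{T}).\mathsf{isCNF}(t)$, with $<$ and $\leq$ inherited from $\mathcal{T}$. Definitions (with respect to $<,\leq$ on $\mathsf{Cnf}$): $\mathsf{is\text{ - }zero}(a) := \forall b.\, a \leq b$. $a \text{ is-suc-of } b := (b < a) \times \forall x.\,(b < x \to a \leq x)$. $\mathsf{is\text{ - }str\text{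 - }suc}(a) := \Sigma(b).\,(a \text{ is-suc-of } b) \times \forall x.\,(x < a \to x \leq b)$. For $f : \mathbb{N} \to \mathsf{Cnf}$, $a \text{ is-sup-of } f := (\forall i. f(i) \leq a) \times \forall x.\,((\forall i. f(i) \leq x) \to a \leq x)$. $\mathsf{is\text{ - }limit}(a) := \exists(f : \mathbb{N} \to \mathsf{Cnf}).\,(\forall k. f(k) < f(k+1)) \times (a \text{ is-sup-of } f)$, where $\exists$ is the propositional truncation. -}

module Defs where

open import Level using (Level; _⊔_; suc)
open import Data.Nat using (ℕ) renaming (suc to sucℕ)
open import Data.Product using (Σ; Σ-syntax; _×_; _,_; proj₁)
open import Data.Sum using (_⊎_)
open import Relation.Binary.PropositionalEquality using (_≡_)

-- Unlabeled binary trees; node a b represents ω^a + b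
data 𝒯 : Set where
  leaf : 𝒯
  node : 𝒯 → 𝒯 → 𝒯

infix 4 _<ᵀ_ _≤ᵀ_
data _<ᵀ_ : 𝒯 → 𝒯 → Set where
  <₁ : ∀ {a b} → leaf <ᵀ node a b
  <₂ : ∀ {a b c d} → a <ᵀ c → node a b <ᵀ node c d
  <₃ : ∀ {a b d} → b <ᵀ d → node a b <ᵀ node a d

_≤ᵀ_ : 𝒯 → 𝒯 → Set
s ≤ᵀ t = (s <ᵀ t) ⊎ (s ≡ t)

left : 𝒯 → 𝒯
left leaf = leaf
left (node a b) = a

data isCNF : 𝒯 → Set where
  isCNF-leaf : isCNF leaf
  isCNF-node : ∀ {s t} → isCNF s → isCNF t → left t ≤ᵀ s → isCNF (node s t)

Cnf : Set
Cnf = Σ 𝒯 isCNF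

infix 4 _<_ _≤_
_<_ : Cnf → Cnf → Set
a < b = proj₁ a <ᵀ proj₁ b

_≤_ : Cnf → Cnf → Set
a ≤ b = proj₁ a ≤ᵀ proj₁ b

-- Propositional truncation, via its (impredicative) universal property,
-- since --without-K Agda has no HITs.
isProp : ∀ {ℓ} → Set ℓ → Set ℓ
isProp A = (x y : A) → x ≡ y

∥_∥ : ∀ {ℓ} → Set ℓ → Set (suc ℓ)
∥_∥ {ℓ} A = (P : Set ℓ) → isProp P → (A → P) → P

is-zero : Cnf → Set
is-zero a = ∀ b → a ≤ b

_is-suc-of_ : Cnf → Cnf → Set
a is-suc-of b = (b < a) × (∀ x → b < x → a ≤ x)

is-str-suc : Cnf → Set
is-str-suc a = Σ[ b ∈ Cnf ] ((a is-suc-of b) × (∀ x → x < a → x ≤ b))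

_is-sup-of_ : Cnf → (ℕ → Cnf) → Set
a is-sup-of f = (∀ i → f i ≤ a) × (∀ x → (∀ i → f i ≤ x) → a ≤ x)

is-limit : Cnf → Set₁
is-limit a = ∥ Σ[ f ∈ (ℕ → Cnf) ] ((∀ k → f k < f (sucℕ k)) × (a is-sup-of f)) ∥

{-# OPTIONS --safe #-}
module Submission where

-- By induction on the CNF ω^a + b. If b ≠ 0 the cases of b transfer to ω^a + b: a greatest
-- element c below b gives ω^a + c, and a cofinal sequence f below b gives ω^a + f(k). If b = 0,
-- then ω^0 = 1 is the successor of 0; if c is the greatest element below a, the sequence
-- ω^c·(k+1) is cofinal below ω^a; and a cofinal sequence f below a gives ω^(f(k)) below ω^a.
-- Since the order on trees is total, a greatest element below x makes x a strong successor,
-- and x is the supremum of any increasing sequence that is cofinal below it.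

open import Defs
open import Data.Empty using (⊥-elim)
open import Data.Nat using (ℕ; zero; suc)
open import Data.Product using (Σ-syntax; _×_; _,_; proj₁; proj₂)
open import Data.Sum using (_⊎_; inj₁; inj₂)
open import Relation.Binary.PropositionalEquality using (_≡_; refl)
open import Relation.Nullary using (¬_)

<ᵀ-trans : ∀ {a b c} → a <ᵀ b → b <ᵀ c → a <ᵀ c
<ᵀ-trans <₁     (<₂ _) = <₁
<ᵀ-trans <₁     (<₃ _) = <₁
<ᵀ-trans (<₂ p) (<₂ q) = <₂ (<ᵀ-trans p q)
<ᵀ-trans (<₂ p) (<₃ _) = <₂ p
<ᵀ-trans (<₃ _) (<₂ q) = <₂ q
<ᵀ-trans (<₃ p) (<₃ q) = <₃ (<ᵀ-trans p q)

<ᵀ-irrefl : ∀ {a} → ¬ (a <ᵀ a)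
<ᵀ-irrefl (<₂ p) = <ᵀ-irrefl p
<ᵀ-irrefl (<₃ p) = <ᵀ-irrefl p

leaf-≤ᵀ : ∀ t → leaf ≤ᵀ t
leaf-≤ᵀ leaf       = inj₂ refl
leaf-≤ᵀ (node _ _) = inj₁ <₁

≤-<ᵀ-trans : ∀ {a b c} → a ≤ᵀ b → b <ᵀ c → a <ᵀ c
≤-<ᵀ-trans (inj₁ a<b)  b<c = <ᵀ-trans a<b b<c
≤-<ᵀ-trans (inj₂ refl) b<c = b<c

≤ᵀ-trans : ∀ {a b c} → a ≤ᵀ b → b ≤ᵀ c → a ≤ᵀ c
≤ᵀ-trans a≤b (inj₁ b<c)  = inj₁ (≤-<ᵀ-trans a≤b b<c)
≤ᵀ-trans a≤b (inj₂ refl) = a≤b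

≤ᵀ⇒≯ᵀ : ∀ {a b} → a ≤ᵀ b → ¬ (b <ᵀ a)
≤ᵀ⇒≯ᵀ a≤b b<a = <ᵀ-irrefl (≤-<ᵀ-trans a≤b b<a)

≤ᵀ-or->ᵀ : ∀ s t → s ≤ᵀ t ⊎ t <ᵀ s
≤ᵀ-or->ᵀ leaf       t          = inj₁ (leaf-≤ᵀ t)
≤ᵀ-or->ᵀ (node a b) leaf       = inj₂ <₁
≤ᵀ-or->ᵀ (node a b) (node c d) with ≤ᵀ-or->ᵀ a c
... | inj₂ c<a         = inj₂ (<₂ c<a)
... | inj₁ (inj₁ a<c)  = inj₁ (inj₁ (<₂ a<c))
... | inj₁ (inj₂ refl) with ≤ᵀ-or->ᵀ b d
...   | inj₂ d<b         = inj₂ (<₃ d<b)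
...   | inj₁ (inj₁ b<d)  = inj₁ (inj₁ (<₃ b<d))
...   | inj₁ (inj₂ refl) = inj₁ (inj₂ refl)

≯ᵀ⇒≤ᵀ : ∀ {s t} → ¬ (t <ᵀ s) → s ≤ᵀ t
≯ᵀ⇒≤ᵀ {s} {t} t≮s with ≤ᵀ-or->ᵀ s t
... | inj₁ s≤t = s≤t
... | inj₂ t<s = ⊥-elim (t≮s t<s)

left-mono : ∀ {s t} → s <ᵀ t → left s ≤ᵀ left t
left-mono {t = t} <₁ = leaf-≤ᵀ (left t)
left-mono (<₂ p)     = inj₁ p
left-mono (<₃ _)     = inj₂ refl

∣_∣ : ∀ {ℓ} {A : Set ℓ} → A → ∥ A ∥
∣ a ∣ = λ _ _ intro → intro a

IsGreatestBelow : 𝒯 → 𝒯 → Set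
IsGreatestBelow c t = c <ᵀ t × (∀ {y} → isCNF y → y <ᵀ t → y ≤ᵀ c)

HasGreatestBelow : 𝒯 → Set
HasGreatestBelow t = Σ[ c ∈ Cnf ] IsGreatestBelow (proj₁ c) t

IsIncreasingCofinal : (ℕ → Cnf) → 𝒯 → Set
IsIncreasingCofinal f t =
  (∀ k → f k < f (suc k)) × (∀ i → proj₁ (f i) <ᵀ t)
  × (∀ {y} → isCNF y → y <ᵀ t → Σ[ i ∈ ℕ ] y <ᵀ proj₁ (f i))

HasIncreasingCofinal : 𝒯 → Set
HasIncreasingCofinal t = Σ[ f ∈ (ℕ → Cnf) ] IsIncreasingCofinal f t

≡leaf⇒is-zero : ∀ {t} (ct : isCNF t) → t ≡ leaf → is-zero (t , ct)
≡leaf⇒is-zero _ refl (y , _) = leaf-≤ᵀ y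

greatestBelow⇒is-str-suc : ∀ {t} (ct : isCNF t) → HasGreatestBelow t → is-str-suc (t , ct)
greatestBelow⇒is-str-suc ct (c , c<t , below≤c) =
  c , (c<t , above-c⇒≥t) , λ (y , cy) → below≤c cy
  where
  above-c⇒≥t : ∀ y → c < y → (_ , ct) ≤ y
  above-c⇒≥t (y , cy) c<y = ≯ᵀ⇒≤ᵀ λ y<t → ≤ᵀ⇒≯ᵀ (below≤c cy y<t) c<y

increasingCofinal⇒is-limit : ∀ {t} (ct : isCNF t) → HasIncreasingCofinal t → is-limit (t , ct)
increasingCofinal⇒is-limit ct (f , f-increasing , f<t , cofinal) =
  ∣ f , f-increasing , (λ i → inj₁ (f<t i)) , upper-bound⇒≥t ∣
  where
  upper-bound⇒≥t : ∀ x → (∀ i → f i ≤ x) → (_ , ct) ≤ x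
  upper-bound⇒≥t (y , cy) f≤y = ≯ᵀ⇒≤ᵀ λ y<t →
    let (i , y<fi) = cofinal cy y<t in ≤ᵀ⇒≯ᵀ (f≤y i) y<fi

ω^_·_ : 𝒯 → ℕ → 𝒯
ω^ c · zero  = leaf
ω^ c · suc k = node c (ω^ c · k)

left-ω^·≤ᵀ : ∀ c k → left (ω^ c · k) ≤ᵀ c
left-ω^·≤ᵀ c zero    = leaf-≤ᵀ c
left-ω^·≤ᵀ c (suc k) = inj₂ refl

ω^·-isCNF : ∀ {c} → isCNF c → ∀ k → isCNF (ω^ c · k)
ω^·-isCNF cc zero    = isCNF-leaf
ω^·-isCNF cc (suc k) = isCNF-node cc (ω^·-isCNF cc k) (left-ω^·≤ᵀ _ k)

ω^·-<ᵀ-suc : ∀ c k → ω^ c · k <ᵀ ω^ c · suc k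
ω^·-<ᵀ-suc c zero    = <₁
ω^·-<ᵀ-suc c (suc k) = <₃ (ω^·-<ᵀ-suc c k)

<ᵀ-ω^·-suc : ∀ c {q} → isCNF q → left q ≤ᵀ c → Σ[ i ∈ ℕ ] q <ᵀ ω^ c · suc i
<ᵀ-ω^·-suc c isCNF-leaf                 _           = 0 , <₁
<ᵀ-ω^·-suc c (isCNF-node _ _ _)         (inj₁ q₁<c) = 0 , <₂ q₁<c
<ᵀ-ω^·-suc c (isCNF-node _ cq₂ lq₂)     (inj₂ refl) =
  let (i , q₂<ω^c·i) = <ᵀ-ω^·-suc c cq₂ lq₂ in suc i , <₃ q₂<ω^c·i

greatestBelow-ω^0 : IsGreatestBelow leaf (node leaf leaf)
greatestBelow-ω^0 = <₁ , λ { {leaf} _ _ → inj₂ refl ; _ (<₂ ()) ; _ (<₃ ()) }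

greatestBelow⇒cofinal-ω^ : ∀ {a} → HasGreatestBelow a → HasIncreasingCofinal (node a leaf)
greatestBelow⇒cofinal-ω^ {a} ((c , cc) , c<a , below≤c) =
  (λ k → ω^ c · suc k , ω^·-isCNF cc (suc k)) ,
  (λ k → ω^·-<ᵀ-suc c (suc k)) , (λ _ → <₂ c<a) , cofinal
  where
  cofinal : ∀ {y} → isCNF y → y <ᵀ node a leaf → Σ[ i ∈ ℕ ] y <ᵀ ω^ c · suc i
  cofinal cy y<ω^a = <ᵀ-ω^·-suc c cy (left-≤ cy y<ω^a)
    where
    left-≤ : ∀ {y} → isCNF y → y <ᵀ node a leaf → left y ≤ᵀ c
    left-≤ isCNF-leaf          _        = leaf-≤ᵀ c
    left-≤ (isCNF-node cp _ _) (<₂ p<a) = below≤c cp p<a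

cofinal⇒cofinal-ω^ : ∀ {a} → HasIncreasingCofinal a → HasIncreasingCofinal (node a leaf)
cofinal⇒cofinal-ω^ {a} (f , f-increasing , f<a , cofinal) =
  ω^∘f , (λ k → <₂ (f-increasing k)) , (λ i → <₂ (f<a i)) , cofinal-ω^
  where
  ω^∘f : ℕ → Cnf
  ω^∘f k = node (proj₁ (f k)) leaf , isCNF-node (proj₂ (f k)) isCNF-leaf (leaf-≤ᵀ _)
  cofinal-ω^ : ∀ {y} → isCNF y → y <ᵀ node a leaf → Σ[ i ∈ ℕ ] y <ᵀ proj₁ (ω^∘f i)
  cofinal-ω^ isCNF-leaf          _        = 0 , <₁
  cofinal-ω^ (isCNF-node cp _ _) (<₂ p<a) = let (i , p<fi) = cofinal cp p<a in i , <₂ p<fi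

greatestBelow-+ : ∀ {a b} → isCNF a → left b ≤ᵀ a →
                  HasGreatestBelow b → HasGreatestBelow (node a b)
greatestBelow-+ {a} {b} ca lb ((c , cc) , c<b , below≤c) =
  (node a c , isCNF-node ca cc (≤ᵀ-trans (left-mono c<b) lb)) , <₃ c<b , below≤a+c
  where
  below≤a+c : ∀ {y} → isCNF y → y <ᵀ node a b → y ≤ᵀ node a c
  below≤a+c _                    <₁       = inj₁ <₁
  below≤a+c _                    (<₂ p<a) = inj₁ (<₂ p<a)
  below≤a+c (isCNF-node _ cq _)  (<₃ q<b) with below≤c cq q<b
  ... | inj₁ q<c  = inj₁ (<₃ q<c)
  ... | inj₂ refl = inj₂ refl

cofinal-+ : ∀ {a b} → isCNF a → left b ≤ᵀ a →
            HasIncreasingCofinal b → HasIncreasingCofinal (node a b)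
cofinal-+ {a} {b} ca lb (f , f-increasing , f<b , cofinal) =
  a+f , (λ k → <₃ (f-increasing k)) , (λ i → <₃ (f<b i)) , cofinal-+f
  where
  a+f : ℕ → Cnf
  a+f k = node a (proj₁ (f k)) , isCNF-node ca (proj₂ (f k)) (≤ᵀ-trans (left-mono (f<b k)) lb)
  cofinal-+f : ∀ {y} → isCNF y → y <ᵀ node a b → Σ[ i ∈ ℕ ] y <ᵀ proj₁ (a+f i)
  cofinal-+f _                   <₁       = 0 , <₁
  cofinal-+f _                   (<₂ p<a) = 0 , <₂ p<a
  cofinal-+f (isCNF-node _ cq _) (<₃ q<b) = let (i , q<fi) = cofinal cq q<b in i , <₃ q<fi

classify : ∀ {t} → isCNF t → t ≡ leaf ⊎ HasGreatestBelow t ⊎ HasIncreasingCofinal t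
classify isCNF-leaf = inj₁ refl
classify (isCNF-node {a} {leaf} ca _ _) with classify ca
... | inj₁ refl        = inj₂ (inj₁ ((leaf , isCNF-leaf) , greatestBelow-ω^0))
... | inj₂ (inj₁ pred) = inj₂ (inj₂ (greatestBelow⇒cofinal-ω^ pred))
... | inj₂ (inj₂ cof)  = inj₂ (inj₂ (cofinal⇒cofinal-ω^ cof))
classify (isCNF-node {a} {node _ _} ca cb lb) with classify cb
... | inj₂ (inj₁ pred) = inj₂ (inj₁ (greatestBelow-+ ca lb pred))
... | inj₂ (inj₂ cof)  = inj₂ (inj₂ (cofinal-+ ca lb cof))

theorem5p9 : (x : Cnf) → is-zero x ⊎ is-str-suc x ⊎ is-limit x
theorem5p9 (t , ct) with classify ct
... | inj₁ t≡leaf      = inj₁ (≡leaf⇒is-zero ct t≡leaf)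
... | inj₂ (inj₁ pred) = inj₂ (inj₁ (greatestBelow⇒is-str-suc ct pred))
... | inj₂ (inj₂ cof)  = inj₂ (inj₂ (increasingCofinal⇒is-limit ct cof))
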